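{- For every calculus $\mathsf{G.WL}$ among the sequent calculi for W-logics and all finite multisets $\Gamma_1,\Gamma_2$ and multisets $\Delta$ of at most one formula: if $\mathsf{G.WL}\vdash\Gamma_1,\Gamma_2\Rightarrow\Delta$, then there is a formula $C$ such that $\mathsf{G.WL}\vdash\Gamma_1\Rightarrow C$, $\mathsf{G.WL}\vdash C,\Gamma_2\Rightarrow\Delta$, and $\mathrm{var}(C)\subseteq\mathrm{var}(\Gamma_1)\cap\mathrm{var}(\Gamma_2,\Delta)$.
   Context: The language $\mathcal{L}$ consists of the formulas built from a countable set $\mathrm{Atm}$ of propositional variables by $A ::= p \mid \bot \mid A\land A \mid A\lor A \mid A\to A \mid \Box A \mid \Diamond A$. For a formula $A$, $\mathrm{var}(A)=\{\bot\}\cup\{p\in\mathrm{Atm}: p\text{ occurs in }A\}$; for a multiset $\Gamma=B_1,\dots,B_n$, $\mathrm{var}(\Gamma)=\mathrm{var}(B_1)\cup\dots\cup\mathrm{var}(B_n)$. Sequents: $\Gamma\Rightarrow\Delta$, $\Gamma$ a finite multiset of formulas, $\Delta$ a multiset of at most one formula; $\Box\Gamma$ denotes $\{\Box A: A\in\Gamma\}$ as a multiset. In all rules $\Gamma,\Gamma'$ are arbitrary finite multisets and $\Delta$ has at most one formula. Propositional rules: (init) $\Gamma,p\Rightarrow p$ for $p\in\mathrm{Atm}$; (L$\bot$) $\Gamma,\bot\Rightarrow\Delta$; (L$\to$) from $\Gamma,A\to B\Rightarrow A$ and $\Gamma,B\Rightarrow\Delta$ infer $\Gamma,A\to B\Rightarrow\Delta$;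 (R$\to$) from $\Gamma,A\Rightarrow B$ infer $\Gamma\Rightarrow A\to B$; (R$\land$) from $\Gamma\Rightarrow A$ and $\Gamma\Rightarrow B$ infer $\Gamma\Rightarrow A\land B$; (L$\land$) from $\Gamma,A,B\Rightarrow\Delta$ infer $\Gamma,A\land B\Rightarrow\Delta$; (R$\lor$) from $\Gamma\Rightarrow A_i$ infer $\Gamma\Rightarrow A_1\lor A_2$ ($i=1,2$); (L$\lor$) from $\Gamma,A\Rightarrow\Delta$ and $\Gamma,B\Rightarrow\Delta$ infer $\Gamma,A\lor B\Rightarrow\Delta$. Modal rules: (M$_\Box$) from $A\Rightarrow B$ infer $\Gamma,\Box A\Rightarrow\Box B$; (M$_\Diamond$) from $A\Rightarrow B$ infer $\Gamma,\Diamond A\Rightarrow\Diamond B$; (Dual$_M$) from $A,B\Rightarrow$ infer $\Gamma,\Box A,\Diamond B\Rightarrow\Delta$; (N$_\Box$) from $\Rightarrow A$ infer $\Gamma\Rightarrow\Box A$; (N$_\Diamond$) from $A\Rightarrow$ infer $\Gamma,\Diamond A\Rightarrow\Delta$; (C$_\Box$) from $\Gamma,A\Rightarrow B$ infer $\Gamma',\Box\Gamma,\Box A\Rightarrow\Box B$; (C$_\Diamond$) from $\Gamma,A\Rightarrow B$ infer $\Gamma',\Box\Gamma,\Diamond A\Rightarrow\Diamond B$; (Dual$_C$) from $\Gamma,A,B\Rightarrow$ infer $\Gamma',\Box\Gamma,\Box A,\Diamond B\Rightarrow\Delta$; (K$_\Box$) from $\Gamma\Rightarrow A$ infer $\Gamma',\Box\Gamma\Rightarrow\Box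 A$; (K$_\Diamond$) from $\Gamma,A\Rightarrow B$ infer $\Gamma',\Box\Gamma,\Diamond A\Rightarrow\Diamond B$; (Dual$_K$) from $\Gamma,A\Rightarrow$ infer $\Gamma',\Box\Gamma,\Diamond A\Rightarrow\Delta$; (T$_\Box$) from $\Gamma,\Box A,A\Rightarrow\Delta$ infer $\Gamma,\Box A\Rightarrow\Delta$; (T$_\Diamond$) from $\Gamma\Rightarrow A$ infer $\Gamma\Rightarrow\Diamond A$; (P$_\Box$) from $A\Rightarrow$ infer $\Gamma,\Box A\Rightarrow\Delta$; (P$_\Diamond$) from $\Rightarrow A$ infer $\Gamma\Rightarrow\Diamond A$; (D) from $A\Rightarrow B$ infer $\Gamma,\Box A\Rightarrow\Diamond B$; (D$_\Box$) from $A,B\Rightarrow$ infer $\Gamma,\Box A,\Box B\Rightarrow\Delta$; (CD) from $\Gamma\Rightarrow A$ infer $\Gamma',\Box\Gamma\Rightarrow\Diamond A$; (CD$_\Box$) from $\Gamma\Rightarrow$ infer $\Gamma',\Box\Gamma\Rightarrow\Delta$. The calculi each contain all propositional rules plus: $\mathsf{G.WM}$: M$_\Box$, M$_\Diamond$, Dual$_M$; $\mathsf{G.WMP}$: $\mathsf{G.WM}$+P$_\Box$+P$_\Diamond$; $\mathsf{G.WMN}$: $\mathsf{G.WM}$+N$_\Box$+N$_\Diamond$; $\mathsf{G.WMNP}$: $\mathsf{G.WMN}$+P$_\Box$+P$_\Diamond$; $\mathsf{G.WMC}$: C$_\Box$, C$_\Diamond$, Dual$_C$; $\mathsf{G.WK}$: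 K$_\Box$, K$_\Diamond$, Dual$_K$; $\mathsf{G.WMD}$: $\mathsf{G.WM}$+D+D$_\Box$+P$_\Box$+P$_\Diamond$; $\mathsf{G.WMND}$: $\mathsf{G.WMN}$+D+D$_\Box$+P$_\Box$+P$_\Diamond$; $\mathsf{G.WMCD}$: $\mathsf{G.WMC}$+CD+CD$_\Box$; $\mathsf{G.WKD}$: $\mathsf{G.WK}$+CD+CD$_\Box$; $\mathsf{G.WMT}$, $\mathsf{G.WMNT}$, $\mathsf{G.WMCT}$, $\mathsf{G.WKT}$: respectively $\mathsf{G.WM}$, $\mathsf{G.WMN}$, $\mathsf{G.WMC}$, $\mathsf{G.WK}$ + T$_\Box$ + T$_\Diamond$. -}

module Defs where

open import Data.Nat using (ℕ)
open import Data.List using (List; []; _∷_; map; _++_)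
open import Data.List.Membership.Propositional using (_∈_)
open import Data.List.Relation.Unary.Any using (Any)
open import Data.List.Relation.Binary.Permutation.Propositional using (_↭_)
open import Data.Maybe using (Maybe; just; nothing)
open import Data.Sum using (_⊎_)

data Fm : Set where
  atom : ℕ → Fm
  ⊥'   : Fm
  _∧'_ : Fm → Fm → Fm
  _∨'_ : Fm → Fm → Fm
  _⇒'_ : Fm → Fm → Fm
  □_   : Fm → Fm
  ◇_   : Fm → Fm

-- p ∈ var(A) for an atom p (⊥ ∈ var(A) always, so only atoms matter).
data Occurs (p : ℕ) : Fm → Set where
  here : Occurs p (atom p)
  ∧l : ∀ {A B} → Occurs p A → Occurs p (A ∧' B)
  ∧r : ∀ {A B} → Occurs p B → Occurs p (A ∧' B)
  ∨l : ∀ {A B} → Occurs p A → Occurs p (A ∨' B)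
  ∨r : ∀ {A B} → Occurs p B → Occurs p (A ∨' B)
  ⇒l : ∀ {A B} → Occurs p A → Occurs p (A ⇒' B)
  ⇒r : ∀ {A B} → Occurs p B → Occurs p (A ⇒' B)
  □o : ∀ {A} → Occurs p A → Occurs p (□ A)
  ◇o : ∀ {A} → Occurs p A → Occurs p (◇ A)

OccursIn : ℕ → List Fm → Set
OccursIn p Γ = Any (Occurs p) Γ

OccursInΔ : ℕ → Maybe Fm → Set
OccursInΔ p nothing  = Data.Empty.⊥
  where import Data.Empty
OccursInΔ p (just A) = Occurs p A

VarCond : Fm → List Fm → List Fm → Maybe Fm → Set
VarCond C Γ₁ Γ₂ Δ = ∀ p → Occurs p C → OccursIn p Γ₁ × (OccursIn p Γ₂ ⊎ OccursInΔ p Δ)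
  where open import Data.Product using (_×_)

data Rule : Set where
  MBox MDia DualM NBox NDia CBox CDia DualC KBox KDia DualK
    TBox TDia PBox PDia D DBox CD CDBox : Rule

data Calc : Set where
  WM WMP WMN WMNP WMC WK WMD WMND WMCD WKD WMT WMNT WMCT WKT : Calc

rules : Calc → List Rule
rules WM   = MBox ∷ MDia ∷ DualM ∷ []
rules WMP  = MBox ∷ MDia ∷ DualM ∷ PBox ∷ PDia ∷ []
rules WMN  = MBox ∷ MDia ∷ DualM ∷ NBox ∷ NDia ∷ []
rules WMNP = MBox ∷ MDia ∷ DualM ∷ NBox ∷ NDia ∷ PBox ∷ PDia ∷ []
rules WMC  = CBox ∷ CDia ∷ DualC ∷ []
rules WK   = KBox ∷ KDia ∷ DualK ∷ []
rules WMD  = MBox ∷ MDia ∷ DualM ∷ D ∷ DBox ∷ PBox ∷ PDia ∷ []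
rules WMND = MBox ∷ MDia ∷ DualM ∷ NBox ∷ NDia ∷ D ∷ DBox ∷ PBox ∷ PDia ∷ []
rules WMCD = CBox ∷ CDia ∷ DualC ∷ CD ∷ CDBox ∷ []
rules WKD  = KBox ∷ KDia ∷ DualK ∷ CD ∷ CDBox ∷ []
rules WMT  = MBox ∷ MDia ∷ DualM ∷ TBox ∷ TDia ∷ []
rules WMNT = MBox ∷ MDia ∷ DualM ∷ NBox ∷ NDia ∷ TBox ∷ TDia ∷ []
rules WMCT = CBox ∷ CDia ∷ DualC ∷ TBox ∷ TDia ∷ []
rules WKT  = KBox ∷ KDia ∷ DualK ∷ TBox ∷ TDia ∷ []

□* : List Fm → List Fm
□* = map □_

-- Derivability  L ⊢ Γ ⇒ Δ.  Antecedents are lists read as multisets: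
-- the rule 'perm' identifies sequents whose antecedents are permutations.
data _⊢_⇒_ (L : Calc) : List Fm → Maybe Fm → Set where
  perm  : ∀ {Γ Γ' Δ} → Γ ↭ Γ' → L ⊢ Γ ⇒ Δ → L ⊢ Γ' ⇒ Δ
  init  : ∀ {Γ p} → L ⊢ atom p ∷ Γ ⇒ just (atom p)
  L⊥    : ∀ {Γ Δ} → L ⊢ ⊥' ∷ Γ ⇒ Δ
  L→    : ∀ {Γ A B Δ} → L ⊢ (A ⇒' B) ∷ Γ ⇒ just A → L ⊢ B ∷ Γ ⇒ Δ → L ⊢ (A ⇒' B) ∷ Γ ⇒ Δ
  R→    : ∀ {Γ A B} → L ⊢ A ∷ Γ ⇒ just B → L ⊢ Γ ⇒ just (A ⇒' B)
  R∧    : ∀ {Γ A B} → L ⊢ Γ ⇒ just A → L ⊢ Γ ⇒ just B → L ⊢ Γ ⇒ just (A ∧' B)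
  L∧    : ∀ {Γ A B Δ} → L ⊢ A ∷ B ∷ Γ ⇒ Δ → L ⊢ (A ∧' B) ∷ Γ ⇒ Δ
  R∨₁   : ∀ {Γ A B} → L ⊢ Γ ⇒ just A → L ⊢ Γ ⇒ just (A ∨' B)
  R∨₂   : ∀ {Γ A B} → L ⊢ Γ ⇒ just B → L ⊢ Γ ⇒ just (A ∨' B)
  L∨    : ∀ {Γ A B Δ} → L ⊢ A ∷ Γ ⇒ Δ → L ⊢ B ∷ Γ ⇒ Δ → L ⊢ (A ∨' B) ∷ Γ ⇒ Δ
  mbox  : ∀ {Γ A B} → MBox ∈ rules L → L ⊢ A ∷ [] ⇒ just B → L ⊢ □ A ∷ Γ ⇒ just (□ B)
  mdia  : ∀ {Γ A B} → MDia ∈ rules L → L ⊢ A ∷ [] ⇒ just B → L ⊢ ◇ A ∷ Γ ⇒ just (◇ B)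
  dualM : ∀ {Γ A B Δ} → DualM ∈ rules L → L ⊢ A ∷ B ∷ [] ⇒ nothing → L ⊢ □ A ∷ ◇ B ∷ Γ ⇒ Δ
  nbox  : ∀ {Γ A} → NBox ∈ rules L → L ⊢ [] ⇒ just A → L ⊢ Γ ⇒ just (□ A)
  ndia  : ∀ {Γ A Δ} → NDia ∈ rules L → L ⊢ A ∷ [] ⇒ nothing → L ⊢ ◇ A ∷ Γ ⇒ Δ
  cbox  : ∀ {Γ Γ' A B} → CBox ∈ rules L → L ⊢ A ∷ Γ ⇒ just B → L ⊢ □ A ∷ □* Γ ++ Γ' ⇒ just (□ B)
  cdia  : ∀ {Γ Γ' A B} → CDia ∈ rules L → L ⊢ A ∷ Γ ⇒ just B → L ⊢ ◇ A ∷ □* Γ ++ Γ' ⇒ just (◇ B)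
  dualC : ∀ {Γ Γ' A B Δ} → DualC ∈ rules L → L ⊢ A ∷ B ∷ Γ ⇒ nothing → L ⊢ □ A ∷ ◇ B ∷ □* Γ ++ Γ' ⇒ Δ
  kbox  : ∀ {Γ Γ' A} → KBox ∈ rules L → L ⊢ Γ ⇒ just A → L ⊢ □* Γ ++ Γ' ⇒ just (□ A)
  kdia  : ∀ {Γ Γ' A B} → KDia ∈ rules L → L ⊢ A ∷ Γ ⇒ just B → L ⊢ ◇ A ∷ □* Γ ++ Γ' ⇒ just (◇ B)
  dualK : ∀ {Γ Γ' A Δ} → DualK ∈ rules L → L ⊢ A ∷ Γ ⇒ nothing → L ⊢ ◇ A ∷ □* Γ ++ Γ' ⇒ Δ
  tbox  : ∀ {Γ A Δ} → TBox ∈ rules L → L ⊢ □ A ∷ A ∷ Γ ⇒ Δ → L ⊢ □ A ∷ Γ ⇒ Δ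
  tdia  : ∀ {Γ A} → TDia ∈ rules L → L ⊢ Γ ⇒ just A → L ⊢ Γ ⇒ just (◇ A)
  pbox  : ∀ {Γ A Δ} → PBox ∈ rules L → L ⊢ A ∷ [] ⇒ nothing → L ⊢ □ A ∷ Γ ⇒ Δ
  pdia  : ∀ {Γ A} → PDia ∈ rules L → L ⊢ [] ⇒ just A → L ⊢ Γ ⇒ just (◇ A)
  d     : ∀ {Γ A B} → D ∈ rules L → L ⊢ A ∷ [] ⇒ just B → L ⊢ □ A ∷ Γ ⇒ just (◇ B)
  dbox  : ∀ {Γ A B Δ} → DBox ∈ rules L → L ⊢ A ∷ B ∷ [] ⇒ nothing → L ⊢ □ A ∷ □ B ∷ Γ ⇒ Δ
  cd    : ∀ {Γ Γ' A} → CD ∈ rules L → L ⊢ Γ ⇒ just A → L ⊢ □* Γ ++ Γ' ⇒ just (◇ A)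
  cdbox : ∀ {Γ Γ' Δ} → CDBox ∈ rules L → L ⊢ Γ ⇒ nothing → L ⊢ □* Γ ++ Γ' ⇒ Δ

module Submission where

-- Maehara's method: by induction on derivations, every splitting of the antecedent, taken up to
-- permutation, has an interpolant; quantifying over all splittings absorbs the permutation rule.
-- For each rule one looks at the side on which its principal formulas fall.  Propositional rules
-- combine the interpolants of their premises with ∧, ∨ or ⇒.  A modal rule turns an interpolant C of
-- its premise into □ C or ◇ C, derived on each side by a rule that the calculus has together with
-- the given one; if the premise has an empty succedent and the principal formulas lie on the left,
-- the interpolant is ¬ □ C for an interpolant C of the premise with the sides exchanged.  When the
-- principal formulas and the context a rule depends on all lie on one side, ⊤ or ⊥ interpolates;
-- this includes the C-rules, which need a boxed principal formula, when one side receives none.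

open import Data.Fin using (#_)
open import Data.List using (List; []; _∷_; _++_; map)
open import Data.List.Membership.Propositional using (_∈_)
open import Data.List.Membership.Propositional.Properties using (∈-lookup; ∈-∃++)
open import Data.List.Properties using (++-assoc; ++-identityʳ)
open import Data.List.Relation.Binary.Permutation.Propositional
  using (_↭_; ↭-refl; ↭-prep; ↭-swap; ↭-trans; ↭-sym; ↭-reflexive; module PermutationReasoning)
open import Data.List.Relation.Binary.Permutation.Propositional.Properties
  using (Any-resp-↭; shift; shifts; drop-∷; ++⁺ˡ; ++⁺ʳ; ++-comm)
open import Data.List.Relation.Unary.All as All using (all?)
open import Data.List.Relation.Unary.Any using (here; there)
import Data.List.Relation.Unary.Any.Properties as Any
open import Data.Maybe using (Maybe; just; nothing)
open import Data.Nat as ℕ using (ℕ)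
open import Data.Product as Product using (Σ; ∃; _×_; _,_)
open import Data.Sum as Sum using (_⊎_; inj₁; inj₂; [_,_])
open import Function using (_∘_; id)
open import Level using (0ℓ)
open import Relation.Binary.Definitions using (DecidableEquality)
open import Relation.Binary.PropositionalEquality using (_≡_; refl; sym; trans; cong)
open import Relation.Nullary.Decidable as Dec using (Dec; True; toWitness; _→-dec_; _⊎-dec_)
open import Relation.Unary using (Pred; _⊆_; _∪_)

open import Defs

variable
  L : Calc
  p : ℕ
  A B C X X₁ X₂ : Fm
  Γ Γ′ Γ₁ Γ₂ Γ₁′ Γ₂′ Θ Θ₁ Θ₂ Λ₁ Λ₂ : List Fm
  Δ Δ′ Δ₁ Δ₂ : Maybe Fm

-- Rules are coded by numbers only to decide membership in  rules L , so that the facts below on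
-- which rules a calculus has together are checked by evaluation.
rule-code : Rule → ℕ
rule-code MBox  = 0
rule-code MDia  = 1
rule-code DualM = 2
rule-code NBox  = 3
rule-code NDia  = 4
rule-code CBox  = 5
rule-code CDia  = 6
rule-code DualC = 7
rule-code KBox  = 8
rule-code KDia  = 9
rule-code DualK = 10
rule-code TBox  = 11
rule-code TDia  = 12
rule-code PBox  = 13
rule-code PDia  = 14
rule-code D     = 15
rule-code DBox  = 16
rule-code CD    = 17
rule-code CDBox = 18

rule-decode : ℕ → Rule
rule-decode 0  = MBox
rule-decode 1  = MDia
rule-decode 2  = DualM
rule-decode 3  = NBox
rule-decode 4  = NDia
rule-decode 5  = CBox
rule-decode 6  = CDia
rule-decode 7  = DualC
rule-decode 8  = KBox
rule-decode 9  = KDia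
rule-decode 10 = DualK
rule-decode 11 = TBox
rule-decode 12 = TDia
rule-decode 13 = PBox
rule-decode 14 = PDia
rule-decode 15 = D
rule-decode 16 = DBox
rule-decode 17 = CD
rule-decode _  = CDBox

rule-decode-code : ∀ r → rule-decode (rule-code r) ≡ r
rule-decode-code MBox  = refl
rule-decode-code MDia  = refl
rule-decode-code DualM = refl
rule-decode-code NBox  = refl
rule-decode-code NDia  = refl
rule-decode-code CBox  = refl
rule-decode-code CDia  = refl
rule-decode-code DualC = refl
rule-decode-code KBox  = refl
rule-decode-code KDia  = refl
rule-decode-code DualK = refl
rule-decode-code TBox  = refl
rule-decode-code TDia  = refl
rule-decode-code PBox  = refl
rule-decode-code PDia  = refl
rule-decode-code D     = refl
rule-decode-code DBox  = refl
rule-decode-code CD    = refl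
rule-decode-code CDBox = refl

rule-code-injective : ∀ {r s} → rule-code r ≡ rule-code s → r ≡ s
rule-code-injective {r} {s} eq =
  trans (sym (rule-decode-code r)) (trans (cong rule-decode eq) (rule-decode-code s))

_≟ʳ_ : DecidableEquality Rule
r ≟ʳ s = Dec.map′ rule-code-injective (cong rule-code) (rule-code r ℕ.≟ rule-code s)

open import Data.List.Membership.DecPropositional _≟ʳ_ using (_∈?_)

all-calcs : List Calc
all-calcs = WM ∷ WMP ∷ WMN ∷ WMNP ∷ WMC ∷ WK ∷ WMD ∷ WMND ∷ WMCD ∷ WKD ∷ WMT ∷ WMNT ∷ WMCT ∷ WKT ∷ []

∈-all-calcs : ∀ L → L ∈ all-calcs
∈-all-calcs WM   = ∈-lookup (# 0)
∈-all-calcs WMP  = ∈-lookup (# 1)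
∈-all-calcs WMN  = ∈-lookup (# 2)
∈-all-calcs WMNP = ∈-lookup (# 3)
∈-all-calcs WMC  = ∈-lookup (# 4)
∈-all-calcs WK   = ∈-lookup (# 5)
∈-all-calcs WMD  = ∈-lookup (# 6)
∈-all-calcs WMND = ∈-lookup (# 7)
∈-all-calcs WMCD = ∈-lookup (# 8)
∈-all-calcs WKD  = ∈-lookup (# 9)
∈-all-calcs WMT  = ∈-lookup (# 10)
∈-all-calcs WMNT = ∈-lookup (# 11)
∈-all-calcs WMCT = ∈-lookup (# 12)
∈-all-calcs WKT  = ∈-lookup (# 13)

by-inspection : {P : Calc → Set} (P? : ∀ L → Dec (P L)) → {True (all? P? all-calcs)} → ∀ {L} → P L
by-inspection P? {holds} {L} = All.lookup (toWitness holds) (∈-all-calcs L)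

dualM⇒mbox : DualM ∈ rules L → MBox ∈ rules L
dualM⇒mbox = by-inspection (λ L → DualM ∈? rules L →-dec MBox ∈? rules L)

dualM⇒mdia : DualM ∈ rules L → MDia ∈ rules L
dualM⇒mdia = by-inspection (λ L → DualM ∈? rules L →-dec MDia ∈? rules L)

dbox⇒mbox : DBox ∈ rules L → MBox ∈ rules L
dbox⇒mbox = by-inspection (λ L → DBox ∈? rules L →-dec MBox ∈? rules L)

d⇒mbox : D ∈ rules L → MBox ∈ rules L
d⇒mbox = by-inspection (λ L → D ∈? rules L →-dec MBox ∈? rules L)

cdia⇒cbox : CDia ∈ rules L → CBox ∈ rules L
cdia⇒cbox = by-inspection (λ L → CDia ∈? rules L →-dec CBox ∈? rules L)

dualC⇒cbox : DualC ∈ rules L → CBox ∈ rules L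
dualC⇒cbox = by-inspection (λ L → DualC ∈? rules L →-dec CBox ∈? rules L)

dualC⇒cdia : DualC ∈ rules L → CDia ∈ rules L
dualC⇒cdia = by-inspection (λ L → DualC ∈? rules L →-dec CDia ∈? rules L)

kdia⇒kbox : KDia ∈ rules L → KBox ∈ rules L
kdia⇒kbox = by-inspection (λ L → KDia ∈? rules L →-dec KBox ∈? rules L)

dualK⇒kbox : DualK ∈ rules L → KBox ∈ rules L
dualK⇒kbox = by-inspection (λ L → DualK ∈? rules L →-dec KBox ∈? rules L)

cd⇒cdia⊎kdia : CD ∈ rules L → CDia ∈ rules L ⊎ KDia ∈ rules L
cd⇒cdia⊎kdia = by-inspection (λ L → CD ∈? rules L →-dec (CDia ∈? rules L ⊎-dec KDia ∈? rules L))

cdbox⇒cbox⊎kbox : CDBox ∈ rules L → CBox ∈ rules L ⊎ KBox ∈ rules L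
cdbox⇒cbox⊎kbox = by-inspection (λ L → CDBox ∈? rules L →-dec (CBox ∈? rules L ⊎-dec KBox ∈? rules L))

module _ {A : Set} where

  swap-heads : ∀ {x y : A} {xs} → x ∷ y ∷ xs ↭ y ∷ x ∷ xs
  swap-heads = ↭-swap _ _ ↭-refl

  rotate₃ : ∀ {x y z : A} {xs} → x ∷ y ∷ z ∷ xs ↭ z ∷ x ∷ y ∷ xs
  rotate₃ = ↭-trans (↭-prep _ swap-heads) swap-heads

  ∈⇒↭∷ : ∀ {x : A} {xs} → x ∈ xs → ∃ λ ys → xs ↭ x ∷ ys
  ∈⇒↭∷ x∈xs with ys , zs , refl ← ∈-∃++ x∈xs = ys ++ zs , shift _ ys zs

  ++-∷-↭ : ∀ xs {x : A} {ys zs} → zs ↭ x ∷ ys → (xs ++ x ∷ []) ++ ys ↭ xs ++ zs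
  ++-∷-↭ xs {x} {ys} ρ = ↭-trans (↭-reflexive (++-assoc xs (x ∷ []) ys)) (++⁺ˡ xs (↭-sym ρ))

  data ∷-Split (x : A) (xs ys zs : List A) : Set where
    inˡ : ∀ ys′ → ys ↭ x ∷ ys′ → xs ↭ ys′ ++ zs → ∷-Split x xs ys zs
    inʳ : ∀ zs′ → zs ↭ x ∷ zs′ → xs ↭ ys ++ zs′ → ∷-Split x xs ys zs

  ∷-split : ∀ {x : A} {xs} ys zs → x ∷ xs ↭ ys ++ zs → ∷-Split x xs ys zs
  ∷-split ys zs σ with Any.++⁻ ys (Any-resp-↭ σ (here refl))
  ... | inj₁ x∈ys with ys′ , ρ ← ∈⇒↭∷ x∈ys =
    inˡ ys′ ρ (drop-∷ (↭-trans σ (++⁺ʳ zs ρ)))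
  ... | inj₂ x∈zs with zs′ , ρ ← ∈⇒↭∷ x∈zs =
    inʳ zs′ ρ (drop-∷ (↭-trans σ (↭-trans (++⁺ˡ ys ρ) (shift _ ys zs′))))

  record MapSplit {B : Set} (f : B → A) (xs : List B) (ys zs : List A) : Set where
    constructor map-split
    field
      xs₁ xs₂   : List B
      ys′ zs′   : List A
      xs↭ : xs ↭ xs₁ ++ xs₂
      ys↭ : ys ↭ map f xs₁ ++ ys′
      zs↭ : zs ↭ map f xs₂ ++ zs′

  map-split-↭ : ∀ {B : Set} (f : B → A) xs {ws} ys zs → map f xs ++ ws ↭ ys ++ zs → MapSplit f xs ys zs
  map-split-↭ f [] ys zs σ = map-split [] [] ys zs ↭-refl ↭-refl ↭-refl
  map-split-↭ f (x ∷ xs) ys zs σ with ∷-split ys zs σ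
  ... | inˡ ys₀ ρ τ with map-split xs₁ xs₂ ys′ zs′ xs↭ ys↭ zs↭ ← map-split-↭ f xs ys₀ zs τ =
    map-split (x ∷ xs₁) xs₂ ys′ zs′ (↭-prep x xs↭) (↭-trans ρ (↭-prep _ ys↭)) zs↭
  ... | inʳ zs₀ ρ τ with map-split xs₁ xs₂ ys′ zs′ xs↭ ys↭ zs↭ ← map-split-↭ f xs ys zs₀ τ =
    map-split xs₁ (x ∷ xs₂) ys′ zs′ (↭-trans (↭-prep x xs↭) (↭-sym (shift x xs₁ xs₂)))
              ys↭ (↭-trans ρ (↭-prep _ zs↭))

weaken : L ⊢ Γ ⇒ Δ → L ⊢ X ∷ Γ ⇒ Δ
weaken (perm π a)  = perm (↭-prep _ π) (weaken a)
weaken init        = perm swap-heads init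
weaken L⊥          = perm swap-heads L⊥
weaken (L→ a b)    = perm swap-heads (L→ (perm swap-heads (weaken a)) (perm swap-heads (weaken b)))
weaken (R→ a)      = R→ (perm swap-heads (weaken a))
weaken (R∧ a b)    = R∧ (weaken a) (weaken b)
weaken (L∧ a)      = perm swap-heads (L∧ (perm (↭-sym rotate₃) (weaken a)))
weaken (R∨₁ a)     = R∨₁ (weaken a)
weaken (R∨₂ a)     = R∨₂ (weaken a)
weaken (L∨ a b)    = perm swap-heads (L∨ (perm swap-heads (weaken a)) (perm swap-heads (weaken b)))
weaken (mbox m a)  = perm swap-heads (mbox m a)
weaken (mdia m a)  = perm swap-heads (mdia m a)
weaken (dualM m a) = perm rotate₃ (dualM m a)
weaken (nbox m a)  = nbox m a
weaken (ndia m a)  = perm swap-heads (ndia m a)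
weaken (cbox {Γ = Γ} m a)  = perm (↭-trans (↭-prep _ (shift _ (□* Γ) _)) swap-heads) (cbox m a)
weaken (cdia {Γ = Γ} m a)  = perm (↭-trans (↭-prep _ (shift _ (□* Γ) _)) swap-heads) (cdia m a)
weaken (dualC {Γ = Γ} m a) = perm (↭-trans (↭-prep _ (↭-prep _ (shift _ (□* Γ) _))) rotate₃) (dualC m a)
weaken (kbox {Γ = Γ} m a)  = perm (shift _ (□* Γ) _) (kbox m a)
weaken (kdia {Γ = Γ} m a)  = perm (↭-trans (↭-prep _ (shift _ (□* Γ) _)) swap-heads) (kdia m a)
weaken (dualK {Γ = Γ} m a) = perm (↭-trans (↭-prep _ (shift _ (□* Γ) _)) swap-heads) (dualK m a)
weaken (tbox m a)  = perm swap-heads (tbox m (perm (↭-sym rotate₃) (weaken a)))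
weaken (tdia m a)  = tdia m (weaken a)
weaken (pbox m a)  = perm swap-heads (pbox m a)
weaken (pdia m a)  = pdia m a
weaken (d m a)     = perm swap-heads (d m a)
weaken (dbox m a)  = perm rotate₃ (dbox m a)
weaken (cd {Γ = Γ} m a)    = perm (shift _ (□* Γ) _) (cd m a)
weaken (cdbox {Γ = Γ} m a) = perm (shift _ (□* Γ) _) (cdbox m a)

cbox-admissible : CBox ∈ rules L ⊎ KBox ∈ rules L →
                  L ⊢ A ∷ Γ ⇒ just B → L ⊢ □ A ∷ □* Γ ++ Γ′ ⇒ just (□ B)
cbox-admissible (inj₁ m) = cbox m
cbox-admissible (inj₂ m) = kbox m

cdia-admissible : CDia ∈ rules L ⊎ KDia ∈ rules L →
                  L ⊢ A ∷ Γ ⇒ just B → L ⊢ ◇ A ∷ □* Γ ++ Γ′ ⇒ just (◇ B)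
cdia-admissible (inj₁ m) = cdia m
cdia-admissible (inj₂ m) = kdia m

var : Fm → Pred ℕ 0ℓ
var A p = Occurs p A

vars : List Fm → Pred ℕ 0ℓ
vars Γ p = OccursIn p Γ

vars⇒ : List Fm → Maybe Fm → Pred ℕ 0ℓ
vars⇒ Γ Δ p = OccursIn p Γ ⊎ OccursInΔ p Δ

var-∧ : var (A ∧' B) ⊆ var A ∪ var B
var-∧ (∧l o) = inj₁ o
var-∧ (∧r o) = inj₂ o

var-∨ : var (A ∨' B) ⊆ var A ∪ var B
var-∨ (∨l o) = inj₁ o
var-∨ (∨r o) = inj₂ o

var-⇒ : var (A ⇒' B) ⊆ var A ∪ var B
var-⇒ (⇒l o) = inj₁ o
var-⇒ (⇒r o) = inj₂ o

var-□ : var (□ A) ⊆ var A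
var-□ (□o o) = o

var-◇ : var (◇ A) ⊆ var A
var-◇ (◇o o) = o

var-¬□ : var ((□ A) ⇒' ⊥') ⊆ var A
var-¬□ (⇒l (□o o)) = o

vars-↭ : Γ ↭ Γ′ → vars Γ ⊆ vars Γ′
vars-↭ ρ = Any-resp-↭ ρ

vars-∷ : var A ⊆ var B → vars Γ ⊆ vars Γ′ → vars (A ∷ Γ) ⊆ vars (B ∷ Γ′)
vars-∷ f g (here o)  = here (f o)
vars-∷ f g (there o) = there (g o)

vars-□*++ : vars Γ ⊆ vars (□* Γ ++ Γ′)
vars-□*++ (here o)  = here (□o o)
vars-□*++ (there o) = there (vars-□*++ o)

vars⇒-nothing : vars Γ ⊆ vars Γ′ → vars⇒ Γ nothing ⊆ vars⇒ Γ′ Δ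
vars⇒-nothing f (inj₁ o) = inj₁ (f o)

VarCond-⊆ : var C ⊆ var A → VarCond A Γ₁ Γ₂ Δ → VarCond C Γ₁ Γ₂ Δ
VarCond-⊆ f v p o = v p (f o)

VarCond-mono : vars Γ₁ ⊆ vars Γ₁′ → vars⇒ Γ₂ Δ ⊆ vars⇒ Γ₂′ Δ′ → VarCond C Γ₁ Γ₂ Δ → VarCond C Γ₁′ Γ₂′ Δ′
VarCond-mono f g v p o = Product.map f g (v p o)

VarCond-swap : vars⇒ Γ₂ Δ ⊆ vars Γ₁′ → vars Γ₁ ⊆ vars⇒ Γ₂′ Δ′ → VarCond C Γ₁ Γ₂ Δ → VarCond C Γ₁′ Γ₂′ Δ′
VarCond-swap f g v p o = Product.map f g (Product.swap (v p o))

VarCond-∪ : var C ⊆ var X₁ ∪ var X₂ → VarCond X₁ Γ₁ Γ₂ Δ → VarCond X₂ Γ₁ Γ₂ Δ → VarCond C Γ₁ Γ₂ Δ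
VarCond-∪ f v₁ v₂ p o = [ v₁ p , v₂ p ] (f o)

record Interpolant (L : Calc) (Γ₁ Γ₂ : List Fm) (Δ : Maybe Fm) : Set where
  constructor interpolant
  field
    formula  : Fm
    left     : L ⊢ Γ₁ ⇒ just formula
    right    : L ⊢ formula ∷ Γ₂ ⇒ Δ
    var-cond : VarCond formula Γ₁ Γ₂ Δ

Interpolant-↭ : Γ₁ ↭ Γ₁′ → Γ₂ ↭ Γ₂′ → Interpolant L Γ₁ Γ₂ Δ → Interpolant L Γ₁′ Γ₂′ Δ
Interpolant-↭ ρ₁ ρ₂ (interpolant C l r v) =
  interpolant C (perm ρ₁ l) (perm (↭-prep C ρ₂) r) (VarCond-mono (vars-↭ ρ₁) (Sum.map₁ (vars-↭ ρ₂)) v)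

⊤-interpolant : L ⊢ Γ₂ ⇒ Δ → Interpolant L Γ₁ Γ₂ Δ
⊤-interpolant ⊢Γ₂ = interpolant (⊥' ⇒' ⊥') (R→ L⊥) (weaken ⊢Γ₂) λ { _ (⇒l ()) ; _ (⇒r ()) }

⊥-interpolant : L ⊢ Γ₁ ⇒ just ⊥' → Interpolant L Γ₁ Γ₂ Δ
⊥-interpolant ⊢Γ₁ = interpolant ⊥' ⊢Γ₁ L⊥ λ _ ()

lift-interpolant : (♯ : Fm → Fm) → (∀ {C} → var (♯ C) ⊆ var C) →
                   vars Θ₁ ⊆ vars Γ₁ → vars⇒ Θ₂ Δ ⊆ vars⇒ Γ₂ Δ′ →
                   (∀ {C} → L ⊢ Θ₁ ⇒ just C → L ⊢ Γ₁ ⇒ just (♯ C)) →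
                   (∀ {C} → L ⊢ C ∷ Θ₂ ⇒ Δ → L ⊢ ♯ C ∷ Γ₂ ⇒ Δ′) →
                   Interpolant L Θ₁ Θ₂ Δ → Interpolant L Γ₁ Γ₂ Δ′
lift-interpolant ♯ var-♯ f g lift-left lift-right (interpolant C l r v) =
  interpolant (♯ C) (lift-left l) (lift-right r) (VarCond-⊆ var-♯ (VarCond-mono f g v))

¬□-interpolant : vars Θ₂ ⊆ vars Γ₁ → vars Θ₁ ⊆ vars Γ₂ →
                 (∀ {C} → L ⊢ C ∷ Θ₂ ⇒ nothing → L ⊢ □ C ∷ Γ₁ ⇒ just ⊥') →
                 (∀ {C} → L ⊢ Θ₁ ⇒ just C → L ⊢ Γ₂ ⇒ just (□ C)) →
                 Interpolant L Θ₁ Θ₂ nothing → Interpolant L Γ₁ Γ₂ Δ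
¬□-interpolant f g refute-left prove-right (interpolant C l r v) =
  interpolant ((□ C) ⇒' ⊥') (R→ (refute-left r)) (L→ (weaken (prove-right l)) L⊥)
    (VarCond-⊆ var-¬□ (VarCond-swap [ f , (λ ()) ] (inj₁ ∘ g) v))

Interpolable : Calc → List Fm → List Fm → List Fm → Maybe Fm → Set
Interpolable L Λ₁ Λ₂ Γ Δ = ∀ Γ₁ Γ₂ → Γ ↭ Γ₁ ++ Γ₂ → Interpolant L (Λ₁ ++ Γ₁) (Λ₂ ++ Γ₂) Δ

Interpolable-↭ : Γ ↭ Γ′ → Interpolable L [] [] Γ Δ → Interpolable L [] [] Γ′ Δ
Interpolable-↭ ρ ih Γ₁ Γ₂ σ = ih Γ₁ Γ₂ (↭-trans ρ σ)

extend : ∀ Θ₁ Θ₂ → Interpolable L [] [] (Θ₁ ++ Θ₂ ++ Γ) Δ → ∀ Γ₁ Γ₂ → Γ ↭ Γ₁ ++ Γ₂ →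
         Interpolant L (Θ₁ ++ Γ₁) (Θ₂ ++ Γ₂) Δ
extend Θ₁ Θ₂ ih Γ₁ Γ₂ σ = ih (Θ₁ ++ Γ₁) (Θ₂ ++ Γ₂) (begin
  Θ₁ ++ Θ₂ ++ _          ↭⟨ ++⁺ˡ Θ₁ (++⁺ˡ Θ₂ σ) ⟩
  Θ₁ ++ Θ₂ ++ Γ₁ ++ Γ₂   ↭⟨ ++⁺ˡ Θ₁ (shifts Θ₂ Γ₁) ⟩
  Θ₁ ++ Γ₁ ++ Θ₂ ++ Γ₂   ≡⟨ ++-assoc Θ₁ Γ₁ _ ⟨
  (Θ₁ ++ Γ₁) ++ Θ₂ ++ Γ₂ ∎)
  where open PermutationReasoning

interpolable-∷ : Interpolable L (Λ₁ ++ X ∷ []) Λ₂ Γ Δ → Interpolable L Λ₁ (Λ₂ ++ X ∷ []) Γ Δ →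
                 Interpolable L Λ₁ Λ₂ (X ∷ Γ) Δ
interpolable-∷ {Λ₁ = Λ₁} {Λ₂ = Λ₂} onˡ onʳ Γ₁ Γ₂ σ with ∷-split Γ₁ Γ₂ σ
... | inˡ Γ₁′ ρ τ = Interpolant-↭ (++-∷-↭ Λ₁ ρ) ↭-refl (onˡ Γ₁′ Γ₂ τ)
... | inʳ Γ₂′ ρ τ = Interpolant-↭ ↭-refl (++-∷-↭ Λ₂ ρ) (onʳ Γ₁ Γ₂′ τ)

interpolable-□* : (∀ {Γ₁ Γ₂} Θ₁ Θ₂ → Γ ↭ Θ₁ ++ Θ₂ →
                     Interpolant L (Λ₁ ++ □* Θ₁ ++ Γ₁) (Λ₂ ++ □* Θ₂ ++ Γ₂) Δ) →
                  Interpolable L Λ₁ Λ₂ (□* Γ ++ Γ′) Δ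
interpolable-□* {Γ = Γ} {Λ₁ = Λ₁} {Λ₂ = Λ₂} canonical Γ₁ Γ₂ σ
  with map-split Θ₁ Θ₂ _ _ π ρ₁ ρ₂ ← map-split-↭ □_ Γ Γ₁ Γ₂ σ =
  Interpolant-↭ (++⁺ˡ Λ₁ (↭-sym ρ₁)) (++⁺ˡ Λ₂ (↭-sym ρ₂)) (canonical Θ₁ Θ₂ π)

L→-interpolant : Interpolant L Γ₂ ((A ⇒' B) ∷ Γ₁) (just A) → Interpolant L (B ∷ Γ₁) Γ₂ Δ →
                 Interpolant L ((A ⇒' B) ∷ Γ₁) Γ₂ Δ
L→-interpolant (interpolant C₁ l₁ r₁ v₁) (interpolant C₂ l₂ r₂ v₂) =
  interpolant (C₁ ⇒' C₂)
    (R→ (perm swap-heads (L→ (perm swap-heads r₁) (perm swap-heads (weaken l₂)))))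
    (L→ (weaken l₁) r₂)
    (VarCond-∪ var-⇒ (VarCond-swap [ id , (λ o → here (⇒l o)) ] inj₁ v₁)
                     (VarCond-mono (vars-∷ ⇒r id) id v₂))

L∨-interpolant : Interpolant L (A ∷ Γ₁) Γ₂ Δ → Interpolant L (B ∷ Γ₁) Γ₂ Δ →
                 Interpolant L ((A ∨' B) ∷ Γ₁) Γ₂ Δ
L∨-interpolant (interpolant C₁ l₁ r₁ v₁) (interpolant C₂ l₂ r₂ v₂) =
  interpolant (C₁ ∨' C₂) (L∨ (R∨₁ l₁) (R∨₂ l₂)) (L∨ r₁ r₂)
    (VarCond-∪ var-∨ (VarCond-mono (vars-∷ ∨l id) id v₁) (VarCond-mono (vars-∷ ∨r id) id v₂))

R∧-interpolant : Interpolant L Γ₁ Γ₂ (just A) → Interpolant L Γ₁ Γ₂ (just B) →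
                 Interpolant L Γ₁ Γ₂ (just (A ∧' B))
R∧-interpolant (interpolant C₁ l₁ r₁ v₁) (interpolant C₂ l₂ r₂ v₂) =
  interpolant (C₁ ∧' C₂) (R∧ l₁ l₂) (R∧ (L∧ (perm swap-heads (weaken r₁))) (L∧ (weaken r₂)))
    (VarCond-∪ var-∧ (VarCond-mono id (Sum.map₂ ∧l) v₁) (VarCond-mono id (Sum.map₂ ∧r) v₂))

∧-interpolant : (∀ {Θ} → L ⊢ X₁ ∷ Θ ⇒ Δ₁ → L ⊢ X₂ ∷ Θ ⇒ Δ₂ → L ⊢ X ∷ Θ ⇒ Δ) →
                vars⇒ (X₁ ∷ Γ₂) Δ₁ ⊆ vars⇒ (X ∷ Γ₂) Δ → vars⇒ (X₂ ∷ Γ₂) Δ₂ ⊆ vars⇒ (X ∷ Γ₂) Δ →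
                Interpolant L Γ₁ (X₁ ∷ Γ₂) Δ₁ → Interpolant L Γ₁ (X₂ ∷ Γ₂) Δ₂ →
                Interpolant L Γ₁ (X ∷ Γ₂) Δ
∧-interpolant rule f₁ f₂ (interpolant C₁ l₁ r₁ v₁) (interpolant C₂ l₂ r₂ v₂) =
  interpolant (C₁ ∧' C₂) (R∧ l₁ l₂)
    (L∧ (perm (↭-sym rotate₃)
              (rule (perm (↭-trans swap-heads rotate₃) (weaken r₁)) (perm rotate₃ (weaken r₂)))))
    (VarCond-∪ var-∧ (VarCond-mono id f₁ v₁) (VarCond-mono id f₂ v₂))

axiom-interpolable : (∀ {Γ Δ} → L ⊢ X ∷ Γ ⇒ Δ) → Interpolable L [] [] (X ∷ Γ) Δ
axiom-interpolable ax = interpolable-∷ (λ _ _ _ → ⊥-interpolant ax) (λ _ _ _ → ⊤-interpolant ax)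

init-interpolable : Interpolable L [] [] (atom p ∷ Γ) (just (atom p))
init-interpolable {p = p} = interpolable-∷
  (λ _ _ _ → interpolant (atom p) init init λ { _ here → here here , inj₂ here })
  (λ _ _ _ → ⊤-interpolant init)

succedent-rule-interpolable : var A ⊆ var B → (∀ {Θ} → L ⊢ Θ ⇒ just A → L ⊢ Θ ⇒ just B) →
                              Interpolable L [] [] Γ (just A) → Interpolable L [] [] Γ (just B)
succedent-rule-interpolable f rule ih Γ₁ Γ₂ σ =
  lift-interpolant id id id (Sum.map₂ f) id rule (ih Γ₁ Γ₂ σ)

merging-rule-interpolable : var A ⊆ var X → var B ⊆ var X →
                            (∀ {Γ Δ} → L ⊢ A ∷ B ∷ Γ ⇒ Δ → L ⊢ X ∷ Γ ⇒ Δ) →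
                            Interpolable L [] [] (A ∷ B ∷ Γ) Δ → Interpolable L [] [] (X ∷ Γ) Δ
merging-rule-interpolable {A = A} {X = X} {B = B} f g rule ih = interpolable-∷
  (λ Γ₁ Γ₂ σ → lift-interpolant id id merged id rule id (extend (A ∷ B ∷ []) [] ih Γ₁ Γ₂ σ))
  (λ Γ₁ Γ₂ σ → lift-interpolant id id id (Sum.map₁ merged)
                  id (λ r → perm swap-heads (rule (perm (↭-sym rotate₃) r)))
                  (extend [] (A ∷ B ∷ []) ih Γ₁ Γ₂ σ))
  where
  merged : vars (A ∷ B ∷ Θ) ⊆ vars (X ∷ Θ)
  merged (here o)          = here (f o)
  merged (there (here o))  = here (g o)
  merged (there (there o)) = there o

R→-interpolable : Interpolable L [] [] (A ∷ Γ) (just B) → Interpolable L [] [] Γ (just (A ⇒' B))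
R→-interpolable {A = A} ih Γ₁ Γ₂ σ =
  lift-interpolant id id id moved id (λ r → R→ (perm swap-heads r)) (extend [] (A ∷ []) ih Γ₁ Γ₂ σ)
  where
  moved : vars⇒ (A ∷ Γ₂) (just B) ⊆ vars⇒ Γ₂ (just (A ⇒' B))
  moved (inj₁ (here o))  = inj₂ (⇒l o)
  moved (inj₁ (there o)) = inj₁ o
  moved (inj₂ o)         = inj₂ (⇒r o)

L→-interpolable : Interpolable L [] [] ((A ⇒' B) ∷ Γ) (just A) → Interpolable L [] [] (B ∷ Γ) Δ →
                  Interpolable L [] [] ((A ⇒' B) ∷ Γ) Δ
L→-interpolable {A = A} {B = B} ihA ihB = interpolable-∷
  (λ Γ₁ Γ₂ σ → L→-interpolant (extend [] ((A ⇒' B) ∷ []) ihA Γ₂ Γ₁ (↭-trans σ (++-comm Γ₁ Γ₂)))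
                              (extend (B ∷ []) [] ihB Γ₁ Γ₂ σ))
  (λ Γ₁ Γ₂ σ → ∧-interpolant L→ [ inj₁ , (λ o → inj₁ (here (⇒l o))) ] (Sum.map₁ (vars-∷ ⇒r id))
                 (extend [] ((A ⇒' B) ∷ []) ihA Γ₁ Γ₂ σ) (extend [] (B ∷ []) ihB Γ₁ Γ₂ σ))

L∨-interpolable : Interpolable L [] [] (A ∷ Γ) Δ → Interpolable L [] [] (B ∷ Γ) Δ →
                  Interpolable L [] [] ((A ∨' B) ∷ Γ) Δ
L∨-interpolable {A = A} {B = B} ihA ihB = interpolable-∷
  (λ Γ₁ Γ₂ σ → L∨-interpolant (extend (A ∷ []) [] ihA Γ₁ Γ₂ σ) (extend (B ∷ []) [] ihB Γ₁ Γ₂ σ))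
  (λ Γ₁ Γ₂ σ → ∧-interpolant L∨ (Sum.map₁ (vars-∷ ∨l id)) (Sum.map₁ (vars-∷ ∨r id))
                 (extend [] (A ∷ []) ihA Γ₁ Γ₂ σ) (extend [] (B ∷ []) ihB Γ₁ Γ₂ σ))

mbox-interpolable : MBox ∈ rules L → L ⊢ A ∷ [] ⇒ just B → Interpolable L [] [] (A ∷ []) (just B) →
                    Interpolable L [] [] (□ A ∷ Γ) (just (□ B))
mbox-interpolable {A = A} m a ih = interpolable-∷
  (λ _ _ _ → lift-interpolant □_ var-□ (vars-∷ □o (λ ())) (Sum.map (λ ()) □o) (mbox m) (mbox m)
               (ih (A ∷ []) [] ↭-refl))
  (λ _ _ _ → ⊤-interpolant (mbox m a))

mdia-interpolable : MDia ∈ rules L → L ⊢ A ∷ [] ⇒ just B → Interpolable L [] [] (A ∷ []) (just B) →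
                    Interpolable L [] [] (◇ A ∷ Γ) (just (◇ B))
mdia-interpolable {A = A} m a ih = interpolable-∷
  (λ _ _ _ → lift-interpolant ◇_ var-◇ (vars-∷ ◇o (λ ())) (Sum.map (λ ()) ◇o) (mdia m) (mdia m)
               (ih (A ∷ []) [] ↭-refl))
  (λ _ _ _ → ⊤-interpolant (mdia m a))

d-interpolable : D ∈ rules L → L ⊢ A ∷ [] ⇒ just B → Interpolable L [] [] (A ∷ []) (just B) →
                 Interpolable L [] [] (□ A ∷ Γ) (just (◇ B))
d-interpolable {A = A} m a ih = interpolable-∷
  (λ _ _ _ → lift-interpolant □_ var-□ (vars-∷ □o (λ ())) (Sum.map (λ ()) ◇o) (mbox (d⇒mbox m)) (d m)
               (ih (A ∷ []) [] ↭-refl))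
  (λ _ _ _ → ⊤-interpolant (d m a))

dualM-interpolable : DualM ∈ rules L → L ⊢ A ∷ B ∷ [] ⇒ nothing →
                     Interpolable L [] [] (A ∷ B ∷ []) nothing →
                     Interpolable L [] [] (□ A ∷ ◇ B ∷ Γ) Δ
dualM-interpolable {A = A} {B = B} m a ih = interpolable-∷
  (interpolable-∷
    (λ _ _ _ → ⊥-interpolant (dualM m a))
    (λ _ _ _ → lift-interpolant □_ var-□ (vars-∷ □o (λ ())) (vars⇒-nothing (vars-∷ ◇o (λ ())))
                 (mbox (dualM⇒mbox m)) (dualM m) (ih (A ∷ []) (B ∷ []) ↭-refl)))
  (interpolable-∷
    (λ _ _ _ → lift-interpolant ◇_ var-◇ (vars-∷ ◇o (λ ())) (vars⇒-nothing (vars-∷ □o (λ ())))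
                 (mdia (dualM⇒mdia m)) (λ r → perm swap-heads (dualM m (perm swap-heads r)))
                 (ih (B ∷ []) (A ∷ []) swap-heads))
    (λ _ _ _ → ⊤-interpolant (dualM m a)))

dbox-interpolable : DBox ∈ rules L → L ⊢ A ∷ B ∷ [] ⇒ nothing →
                    Interpolable L [] [] (A ∷ B ∷ []) nothing →
                    Interpolable L [] [] (□ A ∷ □ B ∷ Γ) Δ
dbox-interpolable {A = A} {B = B} m a ih = interpolable-∷
  (interpolable-∷
    (λ _ _ _ → ⊥-interpolant (dbox m a))
    (λ _ _ _ → lift-interpolant □_ var-□ (vars-∷ □o (λ ())) (vars⇒-nothing (vars-∷ □o (λ ())))
                 (mbox (dbox⇒mbox m)) (dbox m) (ih (A ∷ []) (B ∷ []) ↭-refl)))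
  (interpolable-∷
    (λ _ _ _ → lift-interpolant □_ var-□ (vars-∷ □o (λ ())) (vars⇒-nothing (vars-∷ □o (λ ())))
                 (mbox (dbox⇒mbox m)) (λ r → perm swap-heads (dbox m (perm swap-heads r)))
                 (ih (B ∷ []) (A ∷ []) swap-heads))
    (λ _ _ _ → ⊤-interpolant (dbox m a)))

kbox-interpolable : KBox ∈ rules L → Interpolable L [] [] Γ (just A) →
                    Interpolable L [] [] (□* Γ ++ Γ′) (just (□ A))
kbox-interpolable m ih = interpolable-□* λ Θ₁ Θ₂ π →
  lift-interpolant □_ var-□ vars-□*++ (Sum.map vars-□*++ □o) (kbox m) (kbox m) (ih Θ₁ Θ₂ π)

cd-interpolable : CD ∈ rules L → Interpolable L [] [] Γ (just A) →
                  Interpolable L [] [] (□* Γ ++ Γ′) (just (◇ A))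
cd-interpolable m ih = interpolable-□* λ Θ₁ Θ₂ π →
  lift-interpolant ◇_ var-◇ vars-□*++ (Sum.map vars-□*++ ◇o)
    (cd m) (cdia-admissible (cd⇒cdia⊎kdia m)) (ih Θ₁ Θ₂ π)

cdbox-interpolable : CDBox ∈ rules L → L ⊢ Γ ⇒ nothing → Interpolable L [] [] Γ nothing →
                     Interpolable L [] [] (□* Γ ++ Γ′) Δ
cdbox-interpolable {L = L} {Γ = Γ} m a ih = interpolable-□* canonical
  where
  canonical : ∀ Θ₁ Θ₂ → Γ ↭ Θ₁ ++ Θ₂ → Interpolant L (□* Θ₁ ++ Γ₁) (□* Θ₂ ++ Γ₂) Δ
  canonical Θ₁ []       π =
    ⊥-interpolant (cdbox m (perm (↭-trans π (↭-reflexive (++-identityʳ Θ₁))) a))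
  canonical Θ₁ (E ∷ Θ₂) π =
    ¬□-interpolant vars-□*++ vars-□*++ (cdbox m) (cbox-admissible (cdbox⇒cbox⊎kbox m))
      (ih (E ∷ Θ₂) Θ₁ (↭-trans π (++-comm Θ₁ (E ∷ Θ₂))))

cbox-interpolable : CBox ∈ rules L → L ⊢ A ∷ Γ ⇒ just B → Interpolable L [] [] (A ∷ Γ) (just B) →
                    Interpolable L [] [] (□ A ∷ □* Γ ++ Γ′) (just (□ B))
cbox-interpolable {L = L} {A = A} {Γ = Γ} {B = B} m a ih = interpolable-∷
  (interpolable-□* λ Θ₁ Θ₂ π →
    lift-interpolant □_ var-□ vars-□*++ (Sum.map vars-□*++ □o) (cbox m) (cbox m)
      (ih (A ∷ Θ₁) Θ₂ (↭-prep A π)))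
  (interpolable-□* onʳ)
  where
  onʳ : ∀ Θ₁ Θ₂ → Γ ↭ Θ₁ ++ Θ₂ → Interpolant L (□* Θ₁ ++ Γ₁) (□ A ∷ □* Θ₂ ++ Γ₂) (just (□ B))
  onʳ []       Θ₂ π = ⊤-interpolant (cbox m (perm (↭-prep A π) a))
  onʳ (E ∷ Θ₁) Θ₂ π = lift-interpolant □_ var-□ vars-□*++ (Sum.map vars-□*++ □o)
                        (cbox m) (λ r → perm swap-heads (cbox m (perm swap-heads r)))
                        (extend [] (A ∷ []) ih (E ∷ Θ₁) Θ₂ π)

cdia-interpolable : CDia ∈ rules L → L ⊢ A ∷ Γ ⇒ just B → Interpolable L [] [] (A ∷ Γ) (just B) →
                    Interpolable L [] [] (◇ A ∷ □* Γ ++ Γ′) (just (◇ B))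
cdia-interpolable {L = L} {A = A} {Γ = Γ} {B = B} m a ih = interpolable-∷
  (interpolable-□* λ Θ₁ Θ₂ π →
    lift-interpolant ◇_ var-◇ (vars-∷ ◇o vars-□*++) (Sum.map vars-□*++ ◇o) (cdia m) (cdia m)
      (ih (A ∷ Θ₁) Θ₂ (↭-prep A π)))
  (interpolable-□* onʳ)
  where
  onʳ : ∀ Θ₁ Θ₂ → Γ ↭ Θ₁ ++ Θ₂ → Interpolant L (□* Θ₁ ++ Γ₁) (◇ A ∷ □* Θ₂ ++ Γ₂) (just (◇ B))
  onʳ []       Θ₂ π = ⊤-interpolant (cdia m (perm (↭-prep A π) a))
  onʳ (E ∷ Θ₁) Θ₂ π = lift-interpolant □_ var-□ vars-□*++ (Sum.map (vars-∷ ◇o vars-□*++) ◇o)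
                        (cbox (cdia⇒cbox m)) (λ r → perm swap-heads (cdia m (perm swap-heads r)))
                        (extend [] (A ∷ []) ih (E ∷ Θ₁) Θ₂ π)

kdia-interpolable : KDia ∈ rules L → Interpolable L [] [] (A ∷ Γ) (just B) →
                    Interpolable L [] [] (◇ A ∷ □* Γ ++ Γ′) (just (◇ B))
kdia-interpolable {A = A} m ih = interpolable-∷
  (interpolable-□* λ Θ₁ Θ₂ π →
    lift-interpolant ◇_ var-◇ (vars-∷ ◇o vars-□*++) (Sum.map vars-□*++ ◇o) (kdia m) (kdia m)
      (ih (A ∷ Θ₁) Θ₂ (↭-prep A π)))
  (interpolable-□* λ Θ₁ Θ₂ π →
    lift-interpolant □_ var-□ vars-□*++ (Sum.map (vars-∷ ◇o vars-□*++) ◇o)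
      (kbox (kdia⇒kbox m)) (λ r → perm swap-heads (kdia m (perm swap-heads r)))
      (extend [] (A ∷ []) ih Θ₁ Θ₂ π))

dualK-interpolable : DualK ∈ rules L → Interpolable L [] [] (A ∷ Γ) nothing →
                     Interpolable L [] [] (◇ A ∷ □* Γ ++ Γ′) Δ
dualK-interpolable {L = L} {A = A} m ih = interpolable-∷
  (interpolable-□* λ Θ₁ Θ₂ π →
    ¬□-interpolant (vars-∷ ◇o vars-□*++) vars-□*++ dualK-under-□ (kbox (dualK⇒kbox m))
      (extend [] (A ∷ []) ih Θ₂ Θ₁ (↭-trans π (++-comm Θ₁ Θ₂))))
  (interpolable-□* λ Θ₁ Θ₂ π →
    lift-interpolant □_ var-□ vars-□*++ (vars⇒-nothing (vars-∷ ◇o vars-□*++))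
      (kbox (dualK⇒kbox m)) dualK-under-□ (extend [] (A ∷ []) ih Θ₁ Θ₂ π))
  where
  dualK-under-□ : L ⊢ C ∷ A ∷ Θ ⇒ nothing → L ⊢ □ C ∷ ◇ A ∷ □* Θ ++ Γ ⇒ Δ
  dualK-under-□ r = perm swap-heads (dualK m (perm swap-heads r))

dualC-interpolable : DualC ∈ rules L → L ⊢ A ∷ B ∷ Γ ⇒ nothing →
                     Interpolable L [] [] (A ∷ B ∷ Γ) nothing →
                     Interpolable L [] [] (□ A ∷ ◇ B ∷ □* Γ ++ Γ′) Δ
dualC-interpolable {L = L} {A = A} {B = B} {Γ = Γ} m a ih = interpolable-∷
  (interpolable-∷
    (interpolable-□* both-left)
    (interpolable-□* λ Θ₁ Θ₂ π →
      lift-interpolant □_ var-□ (vars-∷ □o vars-□*++) (vars⇒-nothing (vars-∷ ◇o vars-□*++))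
        (cbox (dualC⇒cbox m)) (dualC m) (extend (A ∷ []) (B ∷ []) ih Θ₁ Θ₂ π)))
  (interpolable-∷
    (interpolable-□* λ Θ₁ Θ₂ π →
      lift-interpolant ◇_ var-◇ (vars-∷ ◇o vars-□*++) (vars⇒-nothing (vars-∷ □o vars-□*++))
        (cdia (dualC⇒cdia m)) (λ r → perm swap-heads (dualC m (perm swap-heads r)))
        (extend (B ∷ []) (A ∷ []) (Interpolable-↭ swap-heads ih) Θ₁ Θ₂ π))
    (interpolable-□* both-right))
  where
  dualC-under-□ : L ⊢ C ∷ A ∷ B ∷ Θ ⇒ nothing → L ⊢ □ C ∷ □ A ∷ ◇ B ∷ □* Θ ++ Γ′ ⇒ Δ
  dualC-under-□ r = perm rotate₃ (dualC m (perm (↭-sym rotate₃) r))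

  both-left : ∀ Θ₁ Θ₂ → Γ ↭ Θ₁ ++ Θ₂ → Interpolant L (□ A ∷ ◇ B ∷ □* Θ₁ ++ Γ₁) (□* Θ₂ ++ Γ₂) Δ
  both-left Θ₁ []       π =
    ⊥-interpolant (dualC m (perm (↭-prep A (↭-prep B (↭-trans π (↭-reflexive (++-identityʳ Θ₁))))) a))
  both-left Θ₁ (E ∷ Θ₂) π =
    ¬□-interpolant (vars-∷ □o (vars-∷ ◇o vars-□*++)) vars-□*++ dualC-under-□ (cbox (dualC⇒cbox m))
      (extend [] (A ∷ B ∷ []) ih (E ∷ Θ₂) Θ₁ (↭-trans π (++-comm Θ₁ (E ∷ Θ₂))))

  both-right : ∀ Θ₁ Θ₂ → Γ ↭ Θ₁ ++ Θ₂ → Interpolant L (□* Θ₁ ++ Γ₁) (□ A ∷ ◇ B ∷ □* Θ₂ ++ Γ₂) Δ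
  both-right []       Θ₂ π = ⊤-interpolant (dualC m (perm (↭-prep A (↭-prep B π)) a))
  both-right (E ∷ Θ₁) Θ₂ π =
    lift-interpolant □_ var-□ vars-□*++ (vars⇒-nothing (vars-∷ □o (vars-∷ ◇o vars-□*++)))
      (cbox (dualC⇒cbox m)) dualC-under-□ (extend [] (A ∷ B ∷ []) ih (E ∷ Θ₁) Θ₂ π)

interpolable : L ⊢ Γ ⇒ Δ → Interpolable L [] [] Γ Δ
interpolable (perm ρ a)  = Interpolable-↭ ρ (interpolable a)
interpolable init        = init-interpolable
interpolable L⊥          = axiom-interpolable L⊥
interpolable (L→ a b)    = L→-interpolable (interpolable a) (interpolable b)
interpolable (R→ a)      = R→-interpolable (interpolable a)
interpolable (R∧ a b) Γ₁ Γ₂ σ = R∧-interpolant (interpolable a Γ₁ Γ₂ σ) (interpolable b Γ₁ Γ₂ σ)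
interpolable (L∧ a)      = merging-rule-interpolable ∧l ∧r L∧ (interpolable a)
interpolable (R∨₁ a)     = succedent-rule-interpolable ∨l R∨₁ (interpolable a)
interpolable (R∨₂ a)     = succedent-rule-interpolable ∨r R∨₂ (interpolable a)
interpolable (L∨ a b)    = L∨-interpolable (interpolable a) (interpolable b)
interpolable (mbox m a)  = mbox-interpolable m a (interpolable a)
interpolable (mdia m a)  = mdia-interpolable m a (interpolable a)
interpolable (dualM m a) = dualM-interpolable m a (interpolable a)
interpolable (nbox m a) _ _ _ = ⊤-interpolant (nbox m a)
interpolable (ndia m a)  = axiom-interpolable (ndia m a)
interpolable (cbox m a)  = cbox-interpolable m a (interpolable a)
interpolable (cdia m a)  = cdia-interpolable m a (interpolable a)
interpolable (dualC m a) = dualC-interpolable m a (interpolable a)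
interpolable (kbox m a)  = kbox-interpolable m (interpolable a)
interpolable (kdia m a)  = kdia-interpolable m (interpolable a)
interpolable (dualK m a) = dualK-interpolable m (interpolable a)
interpolable (tbox m a)  = merging-rule-interpolable id □o (tbox m) (interpolable a)
interpolable (tdia m a)  = succedent-rule-interpolable ◇o (tdia m) (interpolable a)
interpolable (pbox m a)  = axiom-interpolable (pbox m a)
interpolable (pdia m a) _ _ _ = ⊤-interpolant (pdia m a)
interpolable (d m a)     = d-interpolable m a (interpolable a)
interpolable (dbox m a)  = dbox-interpolable m a (interpolable a)
interpolable (cd m a)    = cd-interpolable m (interpolable a)
interpolable (cdbox m a) = cdbox-interpolable m a (interpolable a)

lemma3p10 : (L : Calc) (Γ₁ Γ₂ : List Fm) (Δ : Maybe Fm) →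
    L ⊢ Γ₁ ++ Γ₂ ⇒ Δ →
    Σ Fm (λ C → (L ⊢ Γ₁ ⇒ just C) × (L ⊢ C ∷ Γ₂ ⇒ Δ) × VarCond C Γ₁ Γ₂ Δ)
lemma3p10 L Γ₁ Γ₂ Δ ⊢Γ₁Γ₂ with interpolant C l r v ← interpolable ⊢Γ₁Γ₂ Γ₁ Γ₂ ↭-refl = C , l , r , v
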